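{- Let $k\ge 2$. If $G=K_{k*1}$ or $G=K_{k*2}$ and $N=|V(G)|$, then $va^\equiv_1(G)=\lceil N/2\rceil$.
   Context: All graphs are finite and simple. For a graph $G$ with $N=|V(G)|$ vertices, an equitable $(q,r)$-tree-coloring of $G$ is a partition of $V(G)$ into $q$ sets, each of size $\lfloor N/q\rfloor$ or $\lceil N/q\rceil$, such that each set induces a forest of maximum degree at most $r$. The strong equitable vertex $r$-arboricity $va^\equiv_r(G)$ is the minimum $p$ such that $G$ has an equitable $(q,r)$-tree-coloring for every integer $q\ge p$. $K_{k*n}$ denotes the complete $k$-partite graph with every partite set of size $n$. -}

module Defs where

open import Data.Nat using (ℕ; zero; suc; _+_; _*_; _∸_; _≤_; _<_; _≥_; NonZero)
open import Data.Nat.DivMod using (_/_)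
open import Data.Bool using (Bool; true; false; _∧_; not)
open import Data.Fin using (Fin; toℕ; inject₁; fromℕ)
open import Data.Fin.Properties using (_≟_)
open import Data.List using (List; length; filter)
open import Data.List.Base using (allFin)
open import Data.Nat.Properties using () renaming (_≟_ to _≟ℕ_)
open import Data.Product using (Σ; ∃; _×_; _,_)
open import Relation.Binary.PropositionalEquality using (_≡_; _≢_)
open import Relation.Nullary using (¬_; Dec)
open import Relation.Nullary.Decidable using (⌊_⌋)
open import Data.Empty using (⊥)
open import Data.Sum using (_⊎_)
open import Function.Definitions using (Injective)

record Graph (N : ℕ) : Set where
  field
    Adj   : Fin N → Fin N → Bool
    adj-sym : ∀ u v → Adj u v ≡ Adj v u
    adj-loopless : ∀ v → Adj v v ≡ false
open Graph public

-- Complete k-partite graph K_{k*n}: vertex v (0 ≤ v < k n) lies in part ⌊v/n⌋;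
-- two vertices are adjacent iff they lie in different parts.
K : (k n : ℕ) → .{{_ : NonZero n}} → Graph (k * n)
K k n = record
  { Adj = λ u v → not ⌊ (toℕ u / n) ≟ℕ (toℕ v / n) ⌋
  ; adj-sym = symK
  ; adj-loopless = λ v → loopK v }
  where
  open import Relation.Nullary using (yes; no)
  open import Relation.Binary.PropositionalEquality using (refl; sym)
  symK : ∀ u v → not ⌊ (toℕ u / n) ≟ℕ (toℕ v / n) ⌋ ≡ not ⌊ (toℕ v / n) ≟ℕ (toℕ u / n) ⌋
  symK u v with (toℕ u / n) ≟ℕ (toℕ v / n) | (toℕ v / n) ≟ℕ (toℕ u / n)
  ... | yes _ | yes _ = refl
  ... | no _  | no _  = refl
  ... | yes p | no q  with q (sym p)
  ... | ()
  symK u v | no p | yes q with p (sym q)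
  ... | ()
  loopK : ∀ v → not ⌊ (toℕ v / n) ≟ℕ (toℕ v / n) ⌋ ≡ false
  loopK v with (toℕ v / n) ≟ℕ (toℕ v / n)
  ... | yes _ = refl
  ... | no p with p refl
  ... | ()

count : {N : ℕ} → (Fin N → Bool) → ℕ
count {N} P = length (filter (λ v → Dec-of (P v)) (allFin N))
  where
  open import Data.Bool.Properties using () renaming (_≟_ to _≟B_)
  Dec-of : (b : Bool) → Dec (b ≡ true)
  Dec-of b = b ≟B true

⌈_/_⌉ : ℕ → (q : ℕ) → .{{_ : NonZero q}} → ℕ
⌈ m / q ⌉ = (m + q ∸ 1) / q

module _ {N : ℕ} (G : Graph N) {q : ℕ} (c : Fin N → Fin q) where

  sameCol : Fin N → Fin N → Bool
  sameCol u v = ⌊ c u ≟ c v ⌋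

  classSize : Fin q → ℕ
  classSize i = count (λ v → ⌊ c v ≟ i ⌋)

  inducedDeg : Fin N → ℕ
  inducedDeg v = count (λ w → Adj G v w ∧ sameCol v w)

  -- a cycle (of length m+3 ≥ 3, distinct vertices) inside a single colour class
  MonoCycle : Set
  MonoCycle = Σ ℕ λ m → Σ (Fin (suc (suc (suc m))) → Fin N) λ f →
      Injective _≡_ _≡_ f
    × (∀ (i : Fin (suc (suc m))) → Adj G (f (inject₁ i)) (f (Fin.suc i)) ≡ true)
    × Adj G (f (fromℕ (suc (suc m)))) (f Fin.zero) ≡ true
    × (∀ i → c (f i) ≡ c (f Fin.zero))

record EquitableTreeColoring {N : ℕ} (G : Graph N) (q r : ℕ) .{{_ : NonZero q}} : Set where
  field
    col      : Fin N → Fin q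
    sizes    : ∀ i → (classSize G col i ≡ N / q) ⊎ (classSize G col i ≡ ⌈ N / q ⌉)
    forest   : ¬ MonoCycle G col
    maxDeg   : ∀ v → inducedDeg G col v ≤ r

-- G has an equitable (q,r)-tree-coloring (no partition into 0 sets exists when N>0;
-- we treat q = 0 as never admissible, as q ranges over positive integers).
Colorable : {N : ℕ} → Graph N → ℕ → ℕ → Set
Colorable G zero r = ⊥
Colorable G (suc q) r = EquitableTreeColoring G (suc q) r

IsStrongEqVertArboricity : {N : ℕ} → Graph N → (r p : ℕ) → Set
IsStrongEqVertArboricity G r p =
    (∀ q → q ≥ p → Colorable G q r)
  × (∀ p' → p' < p → ¬ (∀ q → q ≥ p' → Colorable G q r))

module Submission where

-- In K_{k*1} and K_{k*2} any three vertices contain one adjacent to the other two, so a colour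
-- class of an equitable (q,1)-tree-colouring has at most two vertices; summing over the classes
-- gives N ≤ 2q, i.e. q ≥ ⌈N/2⌉. Conversely, if N ≤ 2q, colouring v by v mod q puts at most two
-- vertices in each class (hence a forest of maximum degree 1) and the class sizes lie between
-- ⌊N/q⌋ and ⌈N/q⌉.

open import Defs
open import Data.Nat using (ℕ; _*_; _≥_; ⌈_/2⌉)
open import Data.Product using (_×_; _,_; proj₂)

open import Data.Bool using (Bool; true; false; _∧_; not; if_then_else_)
open import Data.Bool.Properties using () renaming (_≟_ to _≟ᵇ_)
open import Data.Empty using (⊥; ⊥-elim)
open import Data.Fin using (Fin; zero; suc; toℕ; fromℕ<)
open import Data.Fin.Properties using (_≟_; 0≢1+n; suc-injective; toℕ-injective; toℕ-fromℕ<; toℕ<n)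
open import Data.List using (List; []; _∷_; length; filter; allFin)
open import Data.List.Membership.Propositional using (_∈_)
open import Data.List.Membership.Propositional.Properties using (∈-filter⁺; ∈-filter⁻; ∈-allFin)
open import Data.List.Properties using (length-filter; length-tabulate)
open import Data.List.Relation.Unary.All using (_∷_)
open import Data.List.Relation.Unary.AllPairs using (_∷_)
open import Data.List.Relation.Unary.Any using (here; there)
open import Data.List.Relation.Unary.Unique.Propositional using (Unique)
open import Data.List.Relation.Unary.Unique.Propositional.Properties using (filter⁺; allFin⁺)
open import Data.Nat.Base
  using (zero; suc; _+_; _≤_; _<_; z≤n; s≤s; NonZero; ≢-nonZero⁻¹; _/_; _%_; ⌊_/2⌋)
open import Data.Nat.DivMod
  using (_mod_; m≡m%n+[m/n]*n; [m+kn]%n≡m%n; m<n⇒m%n≡m; m%n<n; m<n⇒m/n≡0; m<n*o⇒m/o<n; m/n*n≤m;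
         /-monoˡ-≤; m*n/n≡m; m/n≡1+[m∸n]/n)
open import Data.Nat.Properties
  using (+-0-commutativeMonoid; _<?_; module ≤-Reasoning;
         ≤-refl; ≤-reflexive; ≤-trans; ≤-antisym; <-≤-trans; ≤-<-trans; <⇒≱; ≮⇒≥; m≤n⇒m<n∨m≡n; m≤n⇒m≤1+n;
         +-comm; +-suc; +-identityʳ; +-cancelˡ-≡; +-mono-≤; +-monoˡ-<; +-monoʳ-≤; m≤n+m;
         *-comm; *-identityˡ; *-monoˡ-≤; m≤m*n; m∸n≤m; m+n∸n≡m; ∸-monoˡ-≤;
         n≡⌈n+n/2⌉; ⌈n/2⌉-mono; ⌊n/2⌋≤⌈n/2⌉; ⌊n/2⌋+⌈n/2⌉≡n)
  renaming (_≟_ to _≟ℕ_)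
open import Data.Sum using (_⊎_; inj₁; inj₂)
open import Algebra.Properties.CommutativeMonoid.Sum +-0-commutativeMonoid
  using (sum; sum-cong-≗; sum-replicate-zero; ∑-distrib-+)
open import Relation.Binary.PropositionalEquality
  using (_≡_; _≢_; refl; sym; trans; cong; cong₂; subst; module ≡-Reasoning)
open import Relation.Nullary using (¬_; Dec; yes; no)
open import Relation.Nullary.Decidable using (⌊_⌋)

module _ {p} {A : Set p} where

  from-⌊⌋ : (a? : Dec A) → ⌊ a? ⌋ ≡ true → A
  from-⌊⌋ (yes a) _ = a

  to-⌊⌋ : (a? : Dec A) → A → ⌊ a? ⌋ ≡ true
  to-⌊⌋ (yes _) _ = refl
  to-⌊⌋ (no ¬a) a = ⊥-elim (¬a a)

  to-not⌊⌋ : (a? : Dec A) → ¬ A → not ⌊ a? ⌋ ≡ true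
  to-not⌊⌋ (yes a) ¬a = ⊥-elim (¬a a)
  to-not⌊⌋ (no _)  _  = refl

∧-true⁻ : ∀ {x y} → x ∧ y ≡ true → x ≡ true × y ≡ true
∧-true⁻ {true} {true} _ = refl , refl

module _ {a} {A : Set a} where

  -- The filter used by `count`, so that `count P` is definitionally `length (witnesses P)`.
  select : (A → Bool) → List A → List A
  select P = filter (λ x → P x ≟ᵇ true)

  length-select-∷ : ∀ (P : A → Bool) x xs →
                    length (select P (x ∷ xs)) ≡ (if P x then 1 else 0) + length (select P xs)
  length-select-∷ P x xs with P x
  ... | true  = refl
  ... | false = refl

  ∈⇒1≤length : ∀ {x : A} {xs} → x ∈ xs → 1 ≤ length xs
  ∈⇒1≤length (here _)  = s≤s z≤n
  ∈⇒1≤length (there _) = s≤s z≤n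

  ∈-distinct⇒2≤length : ∀ {x y : A} {xs} → x ≢ y → x ∈ xs → y ∈ xs → 2 ≤ length xs
  ∈-distinct⇒2≤length x≢y (here refl) (here refl)  = ⊥-elim (x≢y refl)
  ∈-distinct⇒2≤length x≢y (here _)    (there y∈)   = s≤s (∈⇒1≤length y∈)
  ∈-distinct⇒2≤length x≢y (there x∈)  (here _)     = s≤s (∈⇒1≤length x∈)
  ∈-distinct⇒2≤length x≢y (there x∈)  (there y∈)   = m≤n⇒m≤1+n (∈-distinct⇒2≤length x≢y x∈ y∈)

  unique⇒length≤1 : ∀ {xs : List A} → Unique xs →
                    (∀ {x y} → x ≢ y → x ∈ xs → y ∈ xs → ⊥) → length xs ≤ 1
  unique⇒length≤1 {[]}         _                   _ = z≤n
  unique⇒length≤1 {_ ∷ []}     _                   _ = s≤s z≤n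
  unique⇒length≤1 {_ ∷ _ ∷ _} ((x≢y ∷ _) ∷ _) noPair =
    ⊥-elim (noPair x≢y (here refl) (there (here refl)))

  unique⇒length≤2 : ∀ {xs : List A} → Unique xs →
                    (∀ {x y z} → x ≢ y → x ≢ z → y ≢ z → x ∈ xs → y ∈ xs → z ∈ xs → ⊥) →
                    length xs ≤ 2
  unique⇒length≤2 {[]}             _                                   _ = z≤n
  unique⇒length≤2 {_ ∷ []}         _                                   _ = s≤s z≤n
  unique⇒length≤2 {_ ∷ _ ∷ []}     _                                   _ = s≤s (s≤s z≤n)
  unique⇒length≤2 {_ ∷ _ ∷ _ ∷ _} ((x≢y ∷ x≢z ∷ _) ∷ (y≢z ∷ _) ∷ _) noTriple =
    ⊥-elim (noTriple x≢y x≢z y≢z (here refl) (there (here refl)) (there (there (here refl))))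

witnesses : ∀ {N} → (Fin N → Bool) → List (Fin N)
witnesses P = select P (allFin _)

module _ {N} (P : Fin N → Bool) where

  ∈-witnesses⁺ : ∀ {v} → P v ≡ true → v ∈ witnesses P
  ∈-witnesses⁺ = ∈-filter⁺ (λ x → P x ≟ᵇ true) (∈-allFin _)

  ∈-witnesses⁻ : ∀ {v} → v ∈ witnesses P → P v ≡ true
  ∈-witnesses⁻ v∈ = proj₂ (∈-filter⁻ (λ x → P x ≟ᵇ true) {xs = allFin N} v∈)

  witnesses-unique : Unique (witnesses P)
  witnesses-unique = filter⁺ (λ x → P x ≟ᵇ true) (allFin⁺ N)

  count≤N : count P ≤ N
  count≤N = ≤-trans (length-filter (λ x → P x ≟ᵇ true) (allFin N)) (≤-reflexive (length-tabulate (λ v → v)))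

  1≤count : ∀ {v} → P v ≡ true → 1 ≤ count P
  1≤count Pv = ∈⇒1≤length (∈-witnesses⁺ Pv)

  2≤count : ∀ {u v} → u ≢ v → P u ≡ true → P v ≡ true → 2 ≤ count P
  2≤count u≢v Pu Pv = ∈-distinct⇒2≤length u≢v (∈-witnesses⁺ Pu) (∈-witnesses⁺ Pv)

  count≤1 : (∀ {u v} → u ≢ v → P u ≡ true → P v ≡ true → ⊥) → count P ≤ 1
  count≤1 noPair = unique⇒length≤1 witnesses-unique
    (λ u≢v u∈ v∈ → noPair u≢v (∈-witnesses⁻ u∈) (∈-witnesses⁻ v∈))

  count≤2 : (∀ {u v w} → u ≢ v → u ≢ w → v ≢ w → P u ≡ true → P v ≡ true → P w ≡ true → ⊥) →
            count P ≤ 2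
  count≤2 noTriple = unique⇒length≤2 witnesses-unique λ u≢v u≢w v≢w u∈ v∈ w∈ →
    noTriple u≢v u≢w v≢w (∈-witnesses⁻ u∈) (∈-witnesses⁻ v∈) (∈-witnesses⁻ w∈)

⌊suc≟suc⌋ : ∀ {q} (j i : Fin q) → ⌊ _≟_ {suc q} (suc j) (suc i) ⌋ ≡ ⌊ j ≟ i ⌋
⌊suc≟suc⌋ j i with j ≟ i
... | yes _ = refl
... | no _  = refl

∑-indicator : ∀ {q} (j : Fin q) → sum (λ i → if ⌊ j ≟ i ⌋ then 1 else 0) ≡ 1
∑-indicator {suc q} zero    = cong suc (sum-replicate-zero q)
∑-indicator {suc q} (suc j) =
  trans (sum-cong-≗ (λ i → cong (if_then 1 else 0) (⌊suc≟suc⌋ j i))) (∑-indicator j)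

∑-length-fibres : ∀ {a} {A : Set a} {q} (f : A → Fin q) xs →
                  sum (λ i → length (select (λ x → ⌊ f x ≟ i ⌋) xs)) ≡ length xs
∑-length-fibres {q = q} f []       = sum-replicate-zero q
∑-length-fibres         f (x ∷ xs) = begin
  sum (λ i → length (select (λ y → ⌊ f y ≟ i ⌋) (x ∷ xs)))
    ≡⟨ sum-cong-≗ (λ i → length-select-∷ (λ y → ⌊ f y ≟ i ⌋) x xs) ⟩
  sum (λ i → indicator i + rest i)
    ≡⟨ ∑-distrib-+ indicator rest ⟩
  sum indicator + sum rest
    ≡⟨ cong₂ _+_ (∑-indicator (f x)) (∑-length-fibres f xs) ⟩
  suc (length xs) ∎
  where
  open ≡-Reasoning
  indicator rest : Fin _ → ℕ
  indicator i = if ⌊ f x ≟ i ⌋ then 1 else 0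
  rest i = length (select (λ y → ⌊ f y ≟ i ⌋) xs)

∑≤ : ∀ {q m} (g : Fin q → ℕ) → (∀ i → g i ≤ m) → sum g ≤ q * m
∑≤ {zero}  g g≤m = z≤n
∑≤ {suc q} g g≤m = +-mono-≤ (g≤m zero) (∑≤ (λ i → g (suc i)) (λ i → g≤m (suc i)))

AtMostTwoToOne : ∀ {N b} {B : Set b} → (Fin N → B) → Set b
AtMostTwoToOne f = ∀ {u v w} → u ≢ v → u ≢ w → v ≢ w → f u ≡ f v → f u ≡ f w → ⊥

module _ {N q} (c : Fin N → Fin q) where

  fibre : Fin q → Fin N → Bool
  fibre i v = ⌊ c v ≟ i ⌋

  fibreSize : Fin q → ℕ
  fibreSize i = count (fibre i)

  ∑-fibreSize : sum fibreSize ≡ N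
  ∑-fibreSize = trans (∑-length-fibres c (allFin N)) (length-tabulate (λ v → v))

  sameFibre : ∀ {i u v} → fibre i u ≡ true → fibre i v ≡ true → c u ≡ c v
  sameFibre {i} {u} {v} u∈i v∈i = trans (from-⌊⌋ (c u ≟ i) u∈i) (sym (from-⌊⌋ (c v ≟ i) v∈i))

  fibreSize≤2 : AtMostTwoToOne c → ∀ i → fibreSize i ≤ 2
  fibreSize≤2 twoToOne i = count≤2 (fibre i) λ u≢v u≢w v≢w u∈i v∈i w∈i →
    twoToOne u≢v u≢w v≢w (sameFibre u∈i v∈i) (sameFibre u∈i w∈i)

  atMostTwoToOne⇒≤2* : AtMostTwoToOne c → N ≤ 2 * q
  atMostTwoToOne⇒≤2* twoToOne = subst (_≤ 2 * q) ∑-fibreSize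
    (subst (sum fibreSize ≤_) (*-comm q 2) (∑≤ fibreSize (fibreSize≤2 twoToOne)))

three-bits : ∀ {a b c} → a < 2 → b < 2 → c < 2 → a ≡ b ⊎ a ≡ c ⊎ b ≡ c
three-bits (s≤s z≤n)       (s≤s z≤n)       _               = inj₁ refl
three-bits (s≤s (s≤s z≤n)) (s≤s (s≤s z≤n)) _               = inj₁ refl
three-bits (s≤s z≤n)       (s≤s (s≤s z≤n)) (s≤s z≤n)       = inj₂ (inj₁ refl)
three-bits (s≤s z≤n)       (s≤s (s≤s z≤n)) (s≤s (s≤s z≤n)) = inj₂ (inj₂ refl)
three-bits (s≤s (s≤s z≤n)) (s≤s z≤n)       (s≤s z≤n)       = inj₂ (inj₂ refl)
three-bits (s≤s (s≤s z≤n)) (s≤s z≤n)       (s≤s (s≤s z≤n)) = inj₂ (inj₁ refl)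

-- Tagging each vertex with one bit separates a fibre into at most two points.
atMostTwoToOne-byBit : ∀ {N b} {B : Set b} (f : Fin N → B) (bit : Fin N → ℕ) →
                       (∀ v → bit v < 2) → (∀ {u v} → f u ≡ f v → bit u ≡ bit v → u ≡ v) →
                       AtMostTwoToOne f
atMostTwoToOne-byBit f bit bit<2 separates {u} {v} {w} u≢v u≢w v≢w fu≡fv fu≡fw
  with three-bits (bit<2 u) (bit<2 v) (bit<2 w)
... | inj₁ eq        = u≢v (separates fu≡fv eq)
... | inj₂ (inj₁ eq) = u≢w (separates fu≡fw eq)
... | inj₂ (inj₂ eq) = v≢w (separates (trans (sym fu≡fv) fu≡fw) eq)

/-%-injective : ∀ {m o} n .{{_ : NonZero n}} → m / n ≡ o / n → m % n ≡ o % n → m ≡ o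
/-%-injective {m} {o} n m/n≡o/n m%n≡o%n = begin
  m                 ≡⟨ m≡m%n+[m/n]*n m n ⟩
  m % n + m / n * n ≡⟨ cong₂ (λ r d → r + d * n) m%n≡o%n m/n≡o/n ⟩
  o % n + o / n * n ≡⟨ m≡m%n+[m/n]*n o n ⟨
  o                 ∎
  where open ≡-Reasoning

adjacent⇒≢ : ∀ {N} (G : Graph N) {u v} → Adj G u v ≡ true → u ≢ v
adjacent⇒≢ G {u} u∼v refl with trans (sym u∼v) (adj-loopless G u)
... | ()

module _ {N} (G : Graph N) {q} (c : Fin N → Fin q) (twoToOne : AtMostTwoToOne c) where

  atMostTwoToOne⇒noMonoCycle : ¬ MonoCycle G c
  atMostTwoToOne⇒noMonoCycle (_ , f , f-injective , _ , _ , colour≡) =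
    twoToOne (λ e → 0≢1+n (f-injective e)) (λ e → 0≢1+n (f-injective e))
             (λ e → 0≢1+n (suc-injective (f-injective e)))
             (sym (colour≡ (suc zero))) (sym (colour≡ (suc (suc zero))))

  atMostTwoToOne⇒inducedDeg≤1 : ∀ v → inducedDeg G c v ≤ 1
  atMostTwoToOne⇒inducedDeg≤1 v = count≤1 (λ w → Adj G v w ∧ sameCol G c v w) λ w≢w′ w∈ w′∈ →
    let v≢w , cv≡cw = neighbour w∈ ; v≢w′ , cv≡cw′ = neighbour w′∈ in
    twoToOne v≢w v≢w′ w≢w′ cv≡cw cv≡cw′
    where
    neighbour : ∀ {w} → (Adj G v w ∧ sameCol G c v w) ≡ true → v ≢ w × c v ≡ c w
    neighbour {w} w∈ = let v∼w , same = ∧-true⁻ w∈ in adjacent⇒≢ G v∼w , from-⌊⌋ (c v ≟ c w) same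

module _ {m q : ℕ} .{{_ : NonZero q}} where

  ≤/⇒*≤ : ∀ {t} → t ≤ m / q → t * q ≤ m
  ≤/⇒*≤ t≤m/q = ≤-trans (*-monoˡ-≤ q t≤m/q) (m/n*n≤m m q)

  *<⇒<⌈/⌉ : ∀ {t} → t * q < m → suc t ≤ ⌈ m / q ⌉
  *<⇒<⌈/⌉ {t} t*q<m = subst (_≤ ⌈ m / q ⌉) (m*n/n≡m (suc t) q) (/-monoˡ-≤ q (∸-monoˡ-≤ 1 suc[t]*q<m+q))
    where
    suc[t]*q<m+q : suc t * q < m + q
    suc[t]*q<m+q = ≤-trans (≤-reflexive (sym (+-suc q (t * q))))
                           (≤-trans (+-monoʳ-≤ q t*q<m) (≤-reflexive (+-comm q m)))

  ⌈/⌉≤1+/ : ⌈ m / q ⌉ ≤ suc (m / q)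
  ⌈/⌉≤1+/ = ≤-trans (/-monoˡ-≤ q (m∸n≤m (m + q) 1))
                    (≤-reflexive (trans (m/n≡1+[m∸n]/n (m≤n+m q m)) (cong (λ n → suc (n / q)) (m+n∸n≡m m q))))

  floor-or-ceil : ∀ {s} → m / q ≤ s → s ≤ ⌈ m / q ⌉ → s ≡ m / q ⊎ s ≡ ⌈ m / q ⌉
  floor-or-ceil m/q≤s s≤⌈m/q⌉ with m≤n⇒m<n∨m≡n m/q≤s
  ... | inj₂ m/q≡s = inj₁ (sym m/q≡s)
  ... | inj₁ m/q<s = inj₂ (≤-antisym s≤⌈m/q⌉ (≤-trans ⌈/⌉≤1+/ m/q<s))

≤-byThresholds : ∀ {m n} → m ≤ 2 → (1 ≤ m → 1 ≤ n) → (2 ≤ m → 2 ≤ n) → m ≤ n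
≤-byThresholds z≤n             _  _  = z≤n
≤-byThresholds (s≤s z≤n)       h₁ _  = h₁ (s≤s z≤n)
≤-byThresholds (s≤s (s≤s z≤n)) _  h₂ = h₂ (s≤s (s≤s z≤n))

module Residue {N q} .{{_ : NonZero q}} (N≤2q : N ≤ 2 * q) where

  residue : Fin N → Fin q
  residue v = toℕ v mod q

  toℕ-residue : ∀ v → toℕ (residue v) ≡ toℕ v % q
  toℕ-residue v = toℕ-fromℕ< (m%n<n (toℕ v) q)

  residue≡⇒%≡ : ∀ {u v} → residue u ≡ residue v → toℕ u % q ≡ toℕ v % q
  residue≡⇒%≡ {u} {v} ru≡rv = trans (sym (toℕ-residue u)) (trans (cong toℕ ru≡rv) (toℕ-residue v))

  residue-atMostTwoToOne : AtMostTwoToOne residue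
  residue-atMostTwoToOne = atMostTwoToOne-byBit residue (λ v → toℕ v / q)
    (λ v → m<n*o⇒m/o<n (<-≤-trans (toℕ<n v) N≤2q))
    (λ ru≡rv u/q≡v/q → toℕ-injective (/-%-injective q u/q≡v/q (residue≡⇒%≡ ru≡rv)))

  inFibre : ∀ i t (lt : toℕ i + t * q < N) → fibre residue i (fromℕ< lt) ≡ true
  inFibre i t lt = to-⌊⌋ (residue (fromℕ< lt) ≟ i) (toℕ-injective (begin
    toℕ (residue (fromℕ< lt)) ≡⟨ toℕ-residue (fromℕ< lt) ⟩
    toℕ (fromℕ< lt) % q       ≡⟨ cong (_% q) (toℕ-fromℕ< lt) ⟩
    (toℕ i + t * q) % q       ≡⟨ [m+kn]%n≡m%n (toℕ i) t q ⟩
    toℕ i % q                 ≡⟨ m<n⇒m%n≡m (toℕ<n i) ⟩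
    toℕ i                     ∎))
    where open ≡-Reasoning

  1≤fibreSize : q ≤ N → ∀ i → 1 ≤ fibreSize residue i
  1≤fibreSize q≤N i = 1≤count (fibre residue i) (inFibre i 0 first<N)
    where
    first<N : toℕ i + 0 * q < N
    first<N = <-≤-trans (+-monoˡ-< 0 (toℕ<n i)) (≤-trans (≤-reflexive (+-identityʳ q)) q≤N)

  2≤fibreSize : 2 * q ≤ N → ∀ i → 2 ≤ fibreSize residue i
  2≤fibreSize 2q≤N i = 2≤count (fibre residue i) first≢second (inFibre i 0 first<N) (inFibre i 1 second<N)
    where
    second<N : toℕ i + 1 * q < N
    second<N = <-≤-trans (+-monoˡ-< (1 * q) (toℕ<n i)) 2q≤N
    first<N : toℕ i + 0 * q < N
    first<N = ≤-<-trans (+-monoʳ-≤ (toℕ i) z≤n) second<N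
    first≢second : fromℕ< first<N ≢ fromℕ< second<N
    first≢second e =
      ≢-nonZero⁻¹ q (trans (sym (*-identityˡ q)) (sym (+-cancelˡ-≡ (toℕ i) _ _ toℕ-first≡toℕ-second)))
      where
      toℕ-first≡toℕ-second : toℕ i + 0 * q ≡ toℕ i + 1 * q
      toℕ-first≡toℕ-second = trans (sym (toℕ-fromℕ< first<N)) (trans (cong toℕ e) (toℕ-fromℕ< second<N))

  fibreSize≤1 : N ≤ q → ∀ i → fibreSize residue i ≤ 1
  fibreSize≤1 N≤q i = count≤1 (fibre residue i) λ {u} {v} u≢v u∈i v∈i →
    u≢v (toℕ-injective (/-%-injective q (trans (quotient≡0 u) (sym (quotient≡0 v)))
                                        (residue≡⇒%≡ (sameFibre residue u∈i v∈i))))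
    where
    quotient≡0 : ∀ v → toℕ v / q ≡ 0
    quotient≡0 v = m<n⇒m/n≡0 (<-≤-trans (toℕ<n v) N≤q)

  floor≤fibreSize : ∀ i → N / q ≤ fibreSize residue i
  floor≤fibreSize i = ≤-byThresholds N/q≤2
    (λ 1≤N/q → 1≤fibreSize (≤-trans (≤-reflexive (sym (*-identityˡ q))) (≤/⇒*≤ 1≤N/q)) i)
    (λ 2≤N/q → 2≤fibreSize (≤/⇒*≤ 2≤N/q) i)
    where
    N/q≤2 : N / q ≤ 2
    N/q≤2 = ≤-trans (/-monoˡ-≤ q N≤2q) (≤-reflexive (m*n/n≡m 2 q))

  fibreSize≤ceil : ∀ i → fibreSize residue i ≤ ⌈ N / q ⌉
  fibreSize≤ceil i = ≤-byThresholds (fibreSize≤2 residue residue-atMostTwoToOne i)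
    (λ 1≤s → *<⇒<⌈/⌉ {m = N} {t = 0} (≤-trans 1≤s (count≤N (fibre residue i))))
    (λ 2≤s → *<⇒<⌈/⌉ {m = N} {t = 1} (≤-trans (≤-reflexive (cong suc (*-identityˡ q))) (q<N 2≤s)))
    where
    q<N : 2 ≤ fibreSize residue i → q < N
    q<N 2≤s with q <? N
    ... | yes q<N = q<N
    ... | no  q≮N = ⊥-elim (<⇒≱ 2≤s (fibreSize≤1 (≮⇒≥ q≮N) i))

  residue-equitable : ∀ i → fibreSize residue i ≡ N / q ⊎ fibreSize residue i ≡ ⌈ N / q ⌉
  residue-equitable i = floor-or-ceil (floor≤fibreSize i) (fibreSize≤ceil i)

≤2*⇒colourable : ∀ {N} (G : Graph N) q → N ≤ 2 * suc q → Colorable G (suc q) 1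
≤2*⇒colourable G q N≤2q = record
  { col    = residue
  ; sizes  = residue-equitable
  ; forest = atMostTwoToOne⇒noMonoCycle G residue residue-atMostTwoToOne
  ; maxDeg = atMostTwoToOne⇒inducedDeg≤1 G residue residue-atMostTwoToOne
  }
  where open Residue N≤2q

centre⇒2≤inducedDeg : ∀ {N} (G : Graph N) {q} (c : Fin N → Fin q) {x y z} →
                      Adj G x y ≡ true → Adj G x z ≡ true → y ≢ z → c x ≡ c y → c x ≡ c z →
                      2 ≤ inducedDeg G c x
centre⇒2≤inducedDeg G c {x} x∼y x∼z y≢z cx≡cy cx≡cz =
  2≤count (λ y → Adj G x y ∧ sameCol G c x y) y≢z (neighbour x∼y cx≡cy) (neighbour x∼z cx≡cz)
  where
  neighbour : ∀ {y} → Adj G x y ≡ true → c x ≡ c y → (Adj G x y ∧ sameCol G c x y) ≡ true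
  neighbour {y} x∼y cx≡cy = cong₂ _∧_ x∼y (to-⌊⌋ (c x ≟ c y) cx≡cy)

AdjacentToBoth : ∀ {N} → Graph N → Fin N → Fin N → Fin N → Set
AdjacentToBoth G x y z = Adj G x y ≡ true × Adj G x z ≡ true

-- On three vertices, having a vertex adjacent to the other two means inducing a connected subgraph.
TriplesConnected : ∀ {N} → Graph N → Set
TriplesConnected G = ∀ {u v w} → u ≢ v → u ≢ w → v ≢ w →
  AdjacentToBoth G u v w ⊎ AdjacentToBoth G v u w ⊎ AdjacentToBoth G w u v

module _ {N} (G : Graph N) (connected : TriplesConnected G) where

  inducedDeg≤1⇒atMostTwoToOne : ∀ {q} (c : Fin N → Fin q) → (∀ v → inducedDeg G c v ≤ 1) → AtMostTwoToOne c
  inducedDeg≤1⇒atMostTwoToOne c deg≤1 {u} {v} {w} u≢v u≢w v≢w cu≡cv cu≡cw with connected u≢v u≢w v≢w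
  ... | inj₁ (u∼v , u∼w)        =
    <⇒≱ (centre⇒2≤inducedDeg G c u∼v u∼w v≢w cu≡cv cu≡cw) (deg≤1 u)
  ... | inj₂ (inj₁ (v∼u , v∼w)) =
    <⇒≱ (centre⇒2≤inducedDeg G c v∼u v∼w u≢w (sym cu≡cv) (trans (sym cu≡cv) cu≡cw)) (deg≤1 v)
  ... | inj₂ (inj₂ (w∼u , w∼v)) =
    <⇒≱ (centre⇒2≤inducedDeg G c w∼u w∼v u≢v (sym cu≡cw) (trans (sym cu≡cw) cu≡cv)) (deg≤1 w)

  colourable⇒≤2* : ∀ {q} → Colorable G q 1 → N ≤ 2 * q
  colourable⇒≤2* {suc q} colouring = atMostTwoToOne⇒≤2* col (inducedDeg≤1⇒atMostTwoToOne col maxDeg)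
    where open EquitableTreeColoring colouring

≤2*⇒⌈/2⌉≤ : ∀ {n m} → n ≤ 2 * m → ⌈ n /2⌉ ≤ m
≤2*⇒⌈/2⌉≤ {n} {m} n≤2m = begin
  ⌈ n /2⌉      ≤⟨ ⌈n/2⌉-mono n≤2m ⟩
  ⌈ 2 * m /2⌉  ≡⟨ cong ⌈_/2⌉ (cong (m +_) (+-identityʳ m)) ⟩
  ⌈ m + m /2⌉  ≡⟨ n≡⌈n+n/2⌉ m ⟨
  m            ∎
  where open ≤-Reasoning

⌈/2⌉≤⇒≤2* : ∀ {n m} → ⌈ n /2⌉ ≤ m → n ≤ 2 * m
⌈/2⌉≤⇒≤2* {n} {m} ⌈n/2⌉≤m = begin
  n                    ≡⟨ ⌊n/2⌋+⌈n/2⌉≡n n ⟨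
  ⌊ n /2⌋ + ⌈ n /2⌉     ≤⟨ +-mono-≤ (≤-trans (⌊n/2⌋≤⌈n/2⌉ n) ⌈n/2⌉≤m) ⌈n/2⌉≤m ⟩
  m + m                ≡⟨ cong (m +_) (+-identityʳ m) ⟨
  2 * m                ∎
  where open ≤-Reasoning

strongEqVertArboricity≡⌈/2⌉ : ∀ {N} (G : Graph N) → 1 ≤ N → TriplesConnected G →
                         IsStrongEqVertArboricity G 1 ⌈ N /2⌉
strongEqVertArboricity≡⌈/2⌉ {N} G 1≤N connected = colourableAbove , notColourableBelow
  where
  colourableAbove : ∀ q → q ≥ ⌈ N /2⌉ → Colorable G q 1
  colourableAbove zero    q≥⌈N/2⌉ = ⊥-elim (<⇒≱ (⌈n/2⌉-mono 1≤N) q≥⌈N/2⌉)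
  colourableAbove (suc q) q≥⌈N/2⌉ = ≤2*⇒colourable G q (⌈/2⌉≤⇒≤2* q≥⌈N/2⌉)

  notColourableBelow : ∀ p → p < ⌈ N /2⌉ → ¬ (∀ q → q ≥ p → Colorable G q 1)
  notColourableBelow p p<⌈N/2⌉ colourableFrom-p =
    <⇒≱ p<⌈N/2⌉ (≤2*⇒⌈/2⌉≤ (colourable⇒≤2* G connected (colourableFrom-p p ≤-refl)))

module _ (k n : ℕ) .{{_ : NonZero n}} where

  part : Fin (k * n) → ℕ
  part x = toℕ x / n

  part-atMostTwoToOne : n ≤ 2 → AtMostTwoToOne part
  part-atMostTwoToOne n≤2 = atMostTwoToOne-byBit part (λ x → toℕ x % n) (λ x → <-≤-trans (m%n<n (toℕ x) n) n≤2)
    (λ px≡py x%n≡y%n → toℕ-injective (/-%-injective n px≡py x%n≡y%n))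

  K-adjacent : ∀ x y → part x ≢ part y → Adj (K k n) x y ≡ true
  K-adjacent x y = to-not⌊⌋ (part x ≟ℕ part y)

  K-triplesConnected : n ≤ 2 → TriplesConnected (K k n)
  K-triplesConnected n≤2 {u} {v} {w} u≢v u≢w v≢w = byParts (part u ≟ℕ part v) (part u ≟ℕ part w)
    where
    byParts : Dec (part u ≡ part v) → Dec (part u ≡ part w) →
              AdjacentToBoth (K k n) u v w ⊎ AdjacentToBoth (K k n) v u w ⊎ AdjacentToBoth (K k n) w u v
    byParts (yes pu≡pv) (yes pu≡pw) = ⊥-elim (part-atMostTwoToOne n≤2 u≢v u≢w v≢w pu≡pv pu≡pw)
    byParts (yes pu≡pv) (no  pu≢pw) = inj₂ (inj₂ (K-adjacent w u (λ pw≡pu → pu≢pw (sym pw≡pu)) ,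
                                                  K-adjacent w v (λ pw≡pv → pu≢pw (trans pu≡pv (sym pw≡pv)))))
    byParts (no  pu≢pv) (yes pu≡pw) = inj₂ (inj₁ (K-adjacent v u (λ pv≡pu → pu≢pv (sym pv≡pu)) ,
                                                  K-adjacent v w (λ pv≡pw → pu≢pv (trans pu≡pw (sym pv≡pw)))))
    byParts (no  pu≢pv) (no  pu≢pw) = inj₁ (K-adjacent u v pu≢pv , K-adjacent u w pu≢pw)

lemma13 : (k : ℕ) → k ≥ 2 →
    IsStrongEqVertArboricity (K k 1) 1 ⌈ (k * 1) /2⌉
    × IsStrongEqVertArboricity (K k 2) 1 ⌈ (k * 2) /2⌉
lemma13 k k≥2 =
    strongEqVertArboricity≡⌈/2⌉ (K k 1) (1≤k*n 1) (K-triplesConnected k 1 (s≤s z≤n))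
  , strongEqVertArboricity≡⌈/2⌉ (K k 2) (1≤k*n 2) (K-triplesConnected k 2 ≤-refl)
  where
  1≤k*n : ∀ n .{{_ : NonZero n}} → 1 ≤ k * n
  1≤k*n n = ≤-trans (s≤s z≤n) (≤-trans k≥2 (m≤m*n k n))
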